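{- Let $a,n$ be integers with $1\le a<n$ and $\gcd(a,n)=1$, let $[q_0,q_1,\dots,q_m]$ be the continued fraction of $n/a$, and let $\mathbf{v}_i=(B_i,A_i)$, $-2\le i\le m$, be defined by $\mathbf{v}_{ -2}=(1,0)$, $\mathbf{v}_{ -1}=(0,1)$, $\mathbf{v}_i=\mathbf{v}_{i-2}+q_i\mathbf{v}_{i-1}$ for $0\le i\le m$ (so $\mathbf{v}_m=(a,n)$). Let $$V_1=\{(B_i,A_i): 0\le i\le m-1,\ i \text{ even}\},\qquad V_2=\{(B_i+1,A_i): 1\le i\le m-1,\ i\text{ odd}\},$$ and let $\mathcal{S}(x,y)=(a+1-x,\,n-y)$. Then $V_1\subset P_1$, $\mathcal{S}(V_1)\subset P_3$, $V_2\subset P_2$ and $\mathcal{S}(V_2)\subset P_4$.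
   Context: $P_{a,n}$ is the parallelogram with vertices $(0,0),(1,0),(a,n),(a+1,n)$, i.e. $\{s(1,0)+t(a,n):0\le s,t\le1\}$. The lines $y=(n/a)(x-\tfrac12)$ and $y=n/2$ cut it into four parallelograms: $P_1=\{s(1,0)+t(a,n): 0\le s\le \tfrac12,\ 0\le t\le\tfrac12\}$ (lower left), $P_2=\{\dots: \tfrac12\le s\le1,\ 0\le t\le \tfrac12\}$ (lower right), $P_3=\{\dots:\tfrac12\le s\le 1,\ \tfrac12\le t\le1\}$ (upper right), $P_4=\{\dots:0\le s\le\tfrac12,\ \tfrac12\le t\le 1\}$ (upper left). The continued fraction $[q_0,\dots,q_m]$ of $n/a$ is the finite expansion $n/a=q_0+1/(q_1+1/(\cdots+1/q_m))$ whose partial quotients are the successive quotients of the Euclidean algorithm applied to $n$ and $a$. -}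

module Defs where

open import Data.Nat as ℕ using (ℕ; zero; suc; _∸_)
open import Data.Nat.DivMod using (_/_; _%_)
open import Data.List using (List; []; _∷_)
open import Data.Product using (_×_; _,_; proj₁; proj₂; Σ; ∃₂)
open import Data.Integer using (ℤ; +_)
open import Data.Rational using (ℚ; 0ℚ; 1ℚ; ½; _+_; _-_; _*_; _≤_)
open import Relation.Binary.PropositionalEquality using (_≡_)

-- Partial quotients of the Euclidean algorithm applied to n and a
-- (continued fraction of n/a), with a fuel argument (fuel ≥ a+1 suffices).
cfAux : ℕ → ℕ → ℕ → List ℕ
cfAux zero    n a       = []
cfAux (suc f) n zero    = []
cfAux (suc f) n (suc a) with n % suc a
... | zero  = n / suc a ∷ []
... | suc r = n / suc a ∷ cfAux f (suc a) (suc r)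

contFrac : ℕ → ℕ → List ℕ
contFrac n a = cfAux (suc n) n a

-- q_i (0 for out-of-range indices)
qAt : List ℕ → ℕ → ℕ
qAt []       _       = 0
qAt (q ∷ qs) zero    = q
qAt (q ∷ qs) (suc i) = qAt qs i

_⊕_ : ℕ × ℕ → ℕ × ℕ → ℕ × ℕ
(x , y) ⊕ (x' , y') = (x ℕ.+ x' , y ℕ.+ y')

_⊛_ : ℕ → ℕ × ℕ → ℕ × ℕ
k ⊛ (x , y) = (k ℕ.* x , k ℕ.* y)

-- wPair qs k = (v_{k-2} , v_{k-1})
wPair : List ℕ → ℕ → (ℕ × ℕ) × (ℕ × ℕ)
wPair qs zero    = ((1 , 0) , (0 , 1))
wPair qs (suc k) with wPair qs k
... | (u , w) = (w , u ⊕ (qAt qs k ⊛ w))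

vv : List ℕ → ℕ → ℕ × ℕ
vv qs i = proj₁ (wPair qs (suc (suc i)))

ℕ→ℚ : ℕ → ℚ
ℕ→ℚ k = (+ k) Data.Rational./ 1

InPar : (sLo sHi tLo tHi : ℚ) (a n : ℕ) (x y : ℚ) → Set
InPar sLo sHi tLo tHi a n x y =
  ∃₂ λ (s t : ℚ) → (sLo ≤ s × s ≤ sHi) × (tLo ≤ t × t ≤ tHi)
                 × (x ≡ s + t * ℕ→ℚ a) × (y ≡ t * ℕ→ℚ n)

P₁ P₂ P₃ P₄ : (a n : ℕ) (x y : ℚ) → Set
P₁ = InPar 0ℚ ½ 0ℚ ½
P₂ = InPar ½ 1ℚ 0ℚ ½
P₃ = InPar ½ 1ℚ ½ 1ℚ
P₄ = InPar 0ℚ ½ ½ 1ℚ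

𝒮 : (a n : ℕ) → ℚ × ℚ → ℚ × ℚ
𝒮 a n (x , y) = (ℕ→ℚ (suc a) - x , ℕ→ℚ n - y)

_∈[_] : ℚ × ℚ → (ℚ → ℚ → Set) → Set
(x , y) ∈[ P ] = P x y

V₁pt : ℕ → ℕ → ℕ → ℚ × ℚ
V₁pt n a i = (ℕ→ℚ (proj₁ (vv (contFrac n a) i)) , ℕ→ℚ (proj₂ (vv (contFrac n a) i)))

V₂pt : ℕ → ℕ → ℕ → ℚ × ℚ
V₂pt n a i = (ℕ→ℚ (suc (proj₁ (vv (contFrac n a) i))) , ℕ→ℚ (proj₂ (vv (contFrac n a) i)))

-- Let v_i = (B_i , A_i) and let r_i be the remainders of the Euclidean
-- algorithm on n and a (r_{-2} = n, r_{-1} = a, r_{i-2} = q_i r_{i-1} + r_i).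
-- By induction B_i n - A_i a = (-1)^i r_i and n = A_i r_{i-1} + A_{i-1} r_i.
-- For i < m we have 1 ≤ r_i < r_{i-1}, hence A_i ≤ n/2, and
-- r_i + r_{i-1} ≤ r_{i-2} ≤ n, hence r_i ≤ n/2.  In the coordinates
-- (x , y) = s (1 , 0) + t (a , n) this says that v_i (i even) has
-- (s , t) = (r_i/n , A_i/n) ∈ [0,½]², and v_i + (1 , 0) (i odd) has
-- (s , t) = (1 - r_i/n , A_i/n) ∈ [½,1] × [0,½].  Finally 𝒮 acts on the
-- coordinates as (s , t) ↦ (1 - s , 1 - t).
module Submission where

open import Defs
open import Data.Nat as ℕ
  using (ℕ; zero; suc; _+_; _*_; _∸_; _≤_; _<_; z≤n; s≤s; parity)
import Data.Nat.Properties as ℕ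
open import Data.Nat.DivMod using (_/_; _%_; m≡m%n+[m/n]*n; m%n<n)
open import Data.Nat.Divisibility using (_∣_; _∤_; divides; ∣-refl; ∣m∣n⇒∣m+n)
open import Data.Nat.GCD using (gcd)
open import Data.Nat.Tactic.RingSolver using (solve-∀)
open import Data.Parity.Base using (Parity; 0ℙ; 1ℙ)
import Data.Parity.Properties as ℙ
open import Data.Integer as ℤ using (+_)
import Data.Integer.Properties as ℤ
open import Data.Rational as ℚ using (ℚ; 0ℚ; 1ℚ; ½; _-_; toℚᵘ)
open import Data.Rational.Properties
  using (toℚᵘ-injective; toℚᵘ-fromℚᵘ; toℚᵘ-cancel-≤; toℚᵘ-homo-+; toℚᵘ-homo-*;
         +-monoʳ-≤; neg-antimono-≤)
open import Data.Rational.Solver using (module +-*-Solver)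
open import Data.Rational.Unnormalised as ℚᵘ using (mkℚᵘ; *≡*; *≤*)
import Data.Rational.Unnormalised.Properties as ℚᵘ
open import Data.List using (List; _∷_; length)
open import Data.Product using (_×_; _,_; proj₁; proj₂)
open import Relation.Nullary using (contradiction)
open import Relation.Binary.PropositionalEquality

frac : ℕ → ℕ → ℚ
frac p n = + p ℚ./ suc n

toℚᵘ-frac : ∀ p n → toℚᵘ (frac p n) ℚᵘ.≃ mkℚᵘ (+ p) n
toℚᵘ-frac p n = toℚᵘ-fromℚᵘ (mkℚᵘ (+ p) n)

module _ where
  open ℚᵘ.≤-Reasoning

  frac-+ : ∀ p q n → frac p n ℚ.+ frac q n ≡ frac (p + q) n
  frac-+ p q n = toℚᵘ-injective (begin-equality
    toℚᵘ (frac p n ℚ.+ frac q n)          ≃⟨ toℚᵘ-homo-+ (frac p n) (frac q n) ⟩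
    toℚᵘ (frac p n) ℚᵘ.+ toℚᵘ (frac q n)  ≃⟨ ℚᵘ.+-cong (toℚᵘ-frac p n) (toℚᵘ-frac q n) ⟩
    mkℚᵘ (+ p) n ℚᵘ.+ mkℚᵘ (+ q) n        ≃⟨ *≡* cross ⟩
    mkℚᵘ (+ (p + q)) n                    ≃⟨ toℚᵘ-frac (p + q) n ⟨
    toℚᵘ (frac (p + q) n)                 ∎)
    where
    N = + suc n
    cross : (+ p ℤ.* N ℤ.+ + q ℤ.* N) ℤ.* N ≡ + (p + q) ℤ.* + (suc n * suc n)
    cross = trans (cong (ℤ._* N) (sym (ℤ.*-distribʳ-+ N (+ p) (+ q))))
                  (trans (ℤ.*-assoc (+ (p + q)) N N)
                         (cong (+ (p + q) ℤ.*_) (sym (ℤ.pos-* (suc n) (suc n)))))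

  -- The denominator of the product is computed as suc (n * 1).
  frac-* : ∀ p q n → frac p n ℚ.* ℕ→ℚ q ≡ frac (p * q) n
  frac-* p q n = toℚᵘ-injective (begin-equality
    toℚᵘ (frac p n ℚ.* ℕ→ℚ q)             ≃⟨ toℚᵘ-homo-* (frac p n) (ℕ→ℚ q) ⟩
    toℚᵘ (frac p n) ℚᵘ.* toℚᵘ (ℕ→ℚ q)     ≃⟨ ℚᵘ.*-cong (toℚᵘ-frac p n) (toℚᵘ-frac q 0) ⟩
    mkℚᵘ (+ p) n ℚᵘ.* mkℚᵘ (+ q) 0        ≃⟨ *≡* cross ⟨
    mkℚᵘ (+ (p * q)) n                    ≃⟨ toℚᵘ-frac (p * q) n ⟨
    toℚᵘ (frac (p * q) n)                 ∎)
    where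
    cross = cong₂ ℤ._*_ (ℤ.pos-* p q) (cong (λ k → + suc k) (ℕ.*-identityʳ n))

  frac-cancel : ∀ p n → frac (p * suc n) n ≡ ℕ→ℚ p
  frac-cancel p n = toℚᵘ-injective (begin-equality
    toℚᵘ (frac (p * suc n) n)  ≃⟨ toℚᵘ-frac (p * suc n) n ⟩
    mkℚᵘ (+ (p * suc n)) n     ≃⟨ *≡* (trans (ℤ.*-identityʳ _) (ℤ.pos-* p (suc n))) ⟩
    mkℚᵘ (+ p) 0               ≃⟨ toℚᵘ-frac p 0 ⟨
    toℚᵘ (ℕ→ℚ p)               ∎)

  frac-≤ : ∀ {p q m n} → p * suc n ≤ q * suc m → frac p m ℚ.≤ frac q n
  frac-≤ {p} {q} {m} {n} p*n≤q*m = toℚᵘ-cancel-≤ (begin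
    toℚᵘ (frac p m)  ≃⟨ toℚᵘ-frac p m ⟩
    mkℚᵘ (+ p) m     ≤⟨ *≤* (subst₂ ℤ._≤_ (ℤ.pos-* p (suc n)) (ℤ.pos-* q (suc m)) (ℤ.+≤+ p*n≤q*m)) ⟩
    mkℚᵘ (+ q) n     ≃⟨ toℚᵘ-frac q n ⟨
    toℚᵘ (frac q n)  ∎)

0≤frac : ∀ p n → 0ℚ ℚ.≤ frac p n
0≤frac p n = frac-≤ {0} {p} {0} {n} z≤n

frac≤½ : ∀ p {n} → p * 2 ≤ suc n → frac p n ℚ.≤ ½
frac≤½ p {n} p*2≤n = frac-≤ {p} {1} {n} {1} (subst (p * 2 ≤_) (sym (ℕ.*-identityˡ (suc n))) p*2≤n)

½≤frac : ∀ p {n} → suc n ≤ p * 2 → ½ ℚ.≤ frac p n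
½≤frac p {n} n≤p*2 = frac-≤ {1} {p} {1} {n} (subst (_≤ p * 2) (sym (ℕ.*-identityˡ (suc n))) n≤p*2)

frac≤1 : ∀ p {n} → p ≤ suc n → frac p n ℚ.≤ 1ℚ
frac≤1 p {n} p≤n = frac-≤ {p} {1} {n} {0} (subst₂ _≤_ (sym (ℕ.*-identityʳ p)) (sym (ℕ.*-identityˡ (suc n))) p≤n)

ℕ→ℚ-suc : ∀ m → ℕ→ℚ (suc m) ≡ 1ℚ ℚ.+ ℕ→ℚ m
ℕ→ℚ-suc m = sym (frac-+ 1 m 0)

InPar-lattice : ∀ {sLo sHi tLo tHi} a n X Y S → X * suc n ≡ S + Y * a →
                sLo ℚ.≤ frac S n → frac S n ℚ.≤ sHi → tLo ℚ.≤ frac Y n → frac Y n ℚ.≤ tHi →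
                InPar sLo sHi tLo tHi a (suc n) (ℕ→ℚ X) (ℕ→ℚ Y)
InPar-lattice a n X Y S X*n≡S+Y*a sLo≤s s≤sHi tLo≤t t≤tHi =
  frac S n , frac Y n , (sLo≤s , s≤sHi) , (tLo≤t , t≤tHi) , x≡ , y≡
  where
  open ≡-Reasoning
  x≡ : ℕ→ℚ X ≡ frac S n ℚ.+ frac Y n ℚ.* ℕ→ℚ a
  x≡ = begin
    ℕ→ℚ X                             ≡⟨ frac-cancel X n ⟨
    frac (X * suc n) n                ≡⟨ cong (λ k → frac k n) X*n≡S+Y*a ⟩
    frac (S + Y * a) n                ≡⟨ frac-+ S (Y * a) n ⟨
    frac S n ℚ.+ frac (Y * a) n       ≡⟨ cong (frac S n ℚ.+_) (frac-* Y a n) ⟨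
    frac S n ℚ.+ frac Y n ℚ.* ℕ→ℚ a   ∎
  y≡ : ℕ→ℚ Y ≡ frac Y n ℚ.* ℕ→ℚ (suc n)
  y≡ = begin
    ℕ→ℚ Y                        ≡⟨ frac-cancel Y n ⟨
    frac (Y * suc n) n           ≡⟨ frac-* Y (suc n) n ⟨
    frac Y n ℚ.* ℕ→ℚ (suc n)     ∎

1-antimono-≤ : ∀ {p q} → p ℚ.≤ q → 1ℚ - q ℚ.≤ 1ℚ - p
1-antimono-≤ p≤q = +-monoʳ-≤ 1ℚ (neg-antimono-≤ p≤q)

InPar-𝒮 : ∀ {sLo sHi tLo tHi} a n {x y} → InPar sLo sHi tLo tHi a n x y →
          𝒮 a n (x , y) ∈[ InPar (1ℚ - sHi) (1ℚ - sLo) (1ℚ - tHi) (1ℚ - tLo) a n ]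
InPar-𝒮 a n (s , t , (sLo≤s , s≤sHi) , (tLo≤t , t≤tHi) , refl , refl) =
  1ℚ - s , 1ℚ - t ,
  (1-antimono-≤ s≤sHi , 1-antimono-≤ sLo≤s) , (1-antimono-≤ t≤tHi , 1-antimono-≤ tLo≤t) ,
  trans (cong (_- (s ℚ.+ t ℚ.* ℕ→ℚ a)) (ℕ→ℚ-suc a))
        (solve 3 (λ s t a → (con 1ℚ :+ a) :- (s :+ t :* a) := (con 1ℚ :- s) :+ (con 1ℚ :- t) :* a)
               refl s t (ℕ→ℚ a)) ,
  solve 2 (λ t n → n :- t :* n := (con 1ℚ :- t) :* n) refl t (ℕ→ℚ n)
  where open +-*-Solver

P₁⇒𝒮∈P₃ : ∀ a n {x y} → (x , y) ∈[ P₁ a n ] → 𝒮 a n (x , y) ∈[ P₃ a n ]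
P₁⇒𝒮∈P₃ = InPar-𝒮

P₂⇒𝒮∈P₄ : ∀ a n {x y} → (x , y) ∈[ P₂ a n ] → 𝒮 a n (x , y) ∈[ P₄ a n ]
P₂⇒𝒮∈P₄ = InPar-𝒮

remainder-step : ∀ {n a} Bu Au Bw Aw R' ρ q {R} →
                 Bu * n ≡ R + Au * a → Aw * a ≡ R' + Bw * n → R ≡ ρ + q * R' →
                 (Bu + q * Bw) * n ≡ ρ + (Au + q * Aw) * a
remainder-step {n} {a} Bu Au Bw Aw R' ρ q u-eq w-eq refl = begin
  (Bu + q * Bw) * n                    ≡⟨ expand Bu q Bw n ⟩
  Bu * n + q * (Bw * n)                ≡⟨ cong (_+ q * (Bw * n)) u-eq ⟩
  ρ + q * R' + Au * a + q * (Bw * n)   ≡⟨ regroup ρ q R' Au a (Bw * n) ⟩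
  ρ + Au * a + q * (R' + Bw * n)       ≡⟨ cong (λ m → ρ + Au * a + q * m) w-eq ⟨
  ρ + Au * a + q * (Aw * a)            ≡⟨ collect ρ Au a q Aw ⟩
  ρ + (Au + q * Aw) * a                ∎
  where
  open ≡-Reasoning
  expand : ∀ Bu q Bw n → (Bu + q * Bw) * n ≡ Bu * n + q * (Bw * n)
  expand = solve-∀
  regroup : ∀ ρ q R' Au a x → ρ + q * R' + Au * a + q * x ≡ ρ + Au * a + q * (R' + x)
  regroup = solve-∀
  collect : ∀ ρ Au a q Aw → ρ + Au * a + q * (Aw * a) ≡ ρ + (Au + q * Aw) * a
  collect = solve-∀

expansion-step : ∀ {n} Au Aw R' ρ q {R} → n ≡ Aw * R + Au * R' → R ≡ ρ + q * R' →
                 n ≡ (Au + q * Aw) * R' + Aw * ρ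
expansion-step Au Aw R' ρ q n≡ refl = trans n≡ (regroup Aw ρ q R' Au)
  where
  regroup : ∀ Aw ρ q R' Au → Aw * (ρ + q * R') + Au * R' ≡ (Au + q * Aw) * R' + Aw * ρ
  regroup = solve-∀

remainder+divisor≤ : ∀ {R R' ρ} q → R ≡ ρ + q * R' → ρ < R' → R' ≤ R → ρ + R' ≤ R
remainder+divisor≤ {ρ = ρ} zero refl ρ<R' R'≤R =
  contradiction (ℕ.<-≤-trans ρ<R' R'≤R) (ℕ.<-irrefl (sym (ℕ.+-identityʳ ρ)))
remainder+divisor≤ {R' = R'} {ρ} (suc q) refl _ _ = ℕ.+-monoʳ-≤ ρ (ℕ.m≤m+n R' (q * R'))

m*2≡m+m : ∀ m → m * 2 ≡ m + m
m*2≡m+m = solve-∀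

m*2≤n⇒n≤[n∸m]*2 : ∀ r {N} → r * 2 ≤ N → N ≤ (N ∸ r) * 2
m*2≤n⇒n≤[n∸m]*2 r {N} r*2≤N = begin
  N                    ≡⟨ ℕ.m∸n+n≡m (ℕ.≤-trans (ℕ.m≤m*n r 2) r*2≤N) ⟨
  N ∸ r + r            ≤⟨ ℕ.+-monoʳ-≤ (N ∸ r) (ℕ.m+n≤o⇒m≤o∸n r (subst (_≤ N) (m*2≡m+m r) r*2≤N)) ⟩
  N ∸ r + (N ∸ r)      ≡⟨ m*2≡m+m (N ∸ r) ⟨
  (N ∸ r) * 2          ∎
  where open ℕ.≤-Reasoning

next : ℕ → (ℕ × ℕ) × (ℕ × ℕ) → (ℕ × ℕ) × (ℕ × ℕ)
next q (u , w) = (w , u ⊕ (q ⊛ w))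

wPairFrom : (ℕ × ℕ) × (ℕ × ℕ) → List ℕ → ℕ → (ℕ × ℕ) × (ℕ × ℕ)
wPairFrom uw qs zero    = uw
wPairFrom uw qs (suc k) = next (qAt qs k) (wPairFrom uw qs k)

wPair≡wPairFrom : ∀ qs k → wPair qs k ≡ wPairFrom ((1 , 0) , (0 , 1)) qs k
wPair≡wPairFrom qs zero    = refl
wPair≡wPairFrom qs (suc k) = cong (next (qAt qs k)) (wPair≡wPairFrom qs k)

wPairFrom-∷ : ∀ uw q qs k → wPairFrom uw (q ∷ qs) (suc k) ≡ wPairFrom (next q uw) qs k
wPairFrom-∷ uw q qs zero    = refl
wPairFrom-∷ uw q qs (suc k) = cong (next (qAt qs k)) (wPairFrom-∷ uw q qs k)

module _ (n a : ℕ) where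

  -- Remainder (parity i) v_i r_i  says  B_i n - A_i a = (-1)^i r_i.
  Remainder : Parity → ℕ × ℕ → ℕ → Set
  Remainder 0ℙ (B , A) r = B * n ≡ r + A * a
  Remainder 1ℙ (B , A) r = A * a ≡ r + B * n

  Remainder-step : ∀ k {u w R R'} ρ q →
                   Remainder (parity k) u R → Remainder (parity (suc k)) w R' → R ≡ ρ + q * R' →
                   Remainder (parity k) (u ⊕ (q ⊛ w)) ρ
  Remainder-step zero          {Bu , Au} {Bw , Aw} {R' = R'} ρ q = remainder-step Bu Au Bw Aw R' ρ q
  Remainder-step (suc zero)    {Bu , Au} {Bw , Aw} {R' = R'} ρ q = remainder-step Au Bu Aw Bw R' ρ q
  Remainder-step (suc (suc k))                               ρ q = Remainder-step k ρ q

  -- The situation before step k: (u , w) = (v_{k-2} , v_{k-1}) and (R , R') = (r_{k-2} , r_{k-1}).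
  record EuclidState (k R R' : ℕ) (u w : ℕ × ℕ) : Set where
    field
      R'≤R        : R' ≤ R
      R≤n         : R ≤ n
      n≡          : n ≡ proj₂ w * R + proj₂ u * R'
      u-remainder : Remainder (parity k) u R
      w-remainder : Remainder (parity (suc k)) w R'

  EuclidState-initial : a ≤ n → EuclidState 0 n a (1 , 0) (0 , 1)
  EuclidState-initial a≤n = record
    { R'≤R        = a≤n
    ; R≤n         = ℕ.≤-refl
    ; n≡          = sym (trans (ℕ.+-identityʳ _) (ℕ.+-identityʳ n))
    ; u-remainder = refl
    ; w-remainder = refl
    }

  record LowerHalf (p : Parity) (v : ℕ × ℕ) : Set where
    field
      remainder      : ℕ
      remainder-eq   : Remainder p v remainder
      remainder-half : remainder * 2 ≤ n
      height-half    : proj₂ v * 2 ≤ n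

  module DivisionStep {k R R' u w} (st : EuclidState k R R' u w) (ρ q : ℕ) (R≡ : R ≡ ρ + q * R') where
    open EuclidState st

    v : ℕ × ℕ
    v = u ⊕ (q ⊛ w)

    v-remainder : Remainder (parity k) v ρ
    v-remainder = Remainder-step k ρ q u-remainder w-remainder R≡

    n≡′ : n ≡ proj₂ v * R' + proj₂ w * ρ
    n≡′ = expansion-step (proj₂ u) (proj₂ w) R' ρ q n≡ R≡

    next-state : ρ ≤ R' → EuclidState (suc k) R' ρ w v
    next-state ρ≤R' = record
      { R'≤R        = ρ≤R'
      ; R≤n         = ℕ.≤-trans R'≤R R≤n
      ; n≡          = n≡′
      ; u-remainder = w-remainder
      ; w-remainder = v-remainder
      }

    lowerHalf : ρ < R' → 0 < ρ → LowerHalf (parity k) v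
    lowerHalf ρ<R' 0<ρ = record
      { remainder      = ρ
      ; remainder-eq   = v-remainder
      ; remainder-half = begin
          ρ * 2     ≡⟨ m*2≡m+m ρ ⟩
          ρ + ρ     ≤⟨ ℕ.+-monoʳ-≤ ρ (ℕ.<⇒≤ ρ<R') ⟩
          ρ + R'    ≤⟨ remainder+divisor≤ q R≡ ρ<R' R'≤R ⟩
          R         ≤⟨ R≤n ⟩
          n         ∎
      ; height-half    = begin
          proj₂ v * 2                  ≤⟨ ℕ.*-monoʳ-≤ (proj₂ v) (ℕ.<-≤-trans (s≤s 0<ρ) ρ<R') ⟩
          proj₂ v * R'                 ≤⟨ ℕ.m≤m+n (proj₂ v * R') (proj₂ w * ρ) ⟩
          proj₂ v * R' + proj₂ w * ρ   ≡⟨ n≡′ ⟨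
          n                            ∎
      }
      where open ℕ.≤-Reasoning

  LowerHalf-convergents : ∀ f R R' {k u w} → EuclidState k R R' u w →
                          ∀ i → suc i < length (cfAux f R R') →
                          LowerHalf (parity (i + k)) (proj₁ (wPairFrom (u , w) (cfAux f R R') (2 + i)))
  LowerHalf-convergents zero    _ _       _ _ ()
  LowerHalf-convergents (suc f) _ zero    _ _ ()
  LowerHalf-convergents (suc f) R (suc c) {k} {u} {w} st i i<len with R % suc c in R%c≡
  ... | zero   = contradiction i<len λ { (s≤s ()) }
  ... | suc ρ' = from i i<len
    where
    q = R / suc c
    R≡ : R ≡ suc ρ' + q * suc c
    R≡ = subst (λ r → R ≡ r + q * suc c) R%c≡ (m≡m%n+[m/n]*n R (suc c))
    ρ<c : suc ρ' < suc c
    ρ<c = subst (_< suc c) R%c≡ (m%n<n R (suc c))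
    rest = cfAux f (suc c) (suc ρ')
    open DivisionStep st (suc ρ') q R≡ using (lowerHalf; next-state)
    from : ∀ i → suc i < suc (length rest) →
           LowerHalf (parity (i + k)) (proj₁ (wPairFrom (u , w) (q ∷ rest) (2 + i)))
    from zero    _           = lowerHalf ρ<c (s≤s z≤n)
    from (suc j) (s≤s j<len) =
      subst₂ LowerHalf (cong parity (ℕ.+-suc j k)) (cong proj₁ (sym (wPairFrom-∷ (u , w) q rest (2 + j))))
             (LowerHalf-convergents f (suc c) (suc ρ') (next-state (ℕ.<⇒≤ ρ<c)) j j<len)

  LowerHalf-vv : a ≤ n → ∀ i → suc i < length (contFrac n a) → LowerHalf (parity i) (vv (contFrac n a) i)
  LowerHalf-vv a≤n i i<len =
    subst₂ LowerHalf (cong parity (ℕ.+-identityʳ i)) (cong proj₁ (sym (wPair≡wPairFrom (contFrac n a) (2 + i))))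
           (LowerHalf-convergents (suc n) n a (EuclidState-initial a≤n) i i<len)

LowerHalf⇒∈P₁ : ∀ {a n B A} → LowerHalf (suc n) a 0ℙ (B , A) → (ℕ→ℚ B , ℕ→ℚ A) ∈[ P₁ a (suc n) ]
LowerHalf⇒∈P₁ {a} {n} {B} {A} record { remainder = r ; remainder-eq = B*n≡r+A*a
                                     ; remainder-half = r*2≤n ; height-half = A*2≤n } =
  InPar-lattice a n B A r B*n≡r+A*a (0≤frac r n) (frac≤½ r r*2≤n) (0≤frac A n) (frac≤½ A A*2≤n)

LowerHalf⇒∈P₂ : ∀ {a n B A} → LowerHalf (suc n) a 1ℙ (B , A) → (ℕ→ℚ (suc B) , ℕ→ℚ A) ∈[ P₂ a (suc n) ]
LowerHalf⇒∈P₂ {a} {n} {B} {A} record { remainder = r ; remainder-eq = A*a≡r+B*n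
                                     ; remainder-half = r*2≤n ; height-half = A*2≤n } =
  InPar-lattice a n (suc B) A (suc n ∸ r) x≡
    (½≤frac (suc n ∸ r) (m*2≤n⇒n≤[n∸m]*2 r r*2≤n)) (frac≤1 (suc n ∸ r) (ℕ.m∸n≤m (suc n) r))
    (0≤frac A n) (frac≤½ A A*2≤n)
  where
  open ≡-Reasoning
  x≡ : suc B * suc n ≡ (suc n ∸ r) + A * a
  x≡ = begin
    suc n + B * suc n              ≡⟨ cong (_+ B * suc n) (ℕ.m∸n+n≡m (ℕ.≤-trans (ℕ.m≤m*n r 2) r*2≤n)) ⟨
    (suc n ∸ r) + r + B * suc n    ≡⟨ ℕ.+-assoc (suc n ∸ r) r (B * suc n) ⟩
    (suc n ∸ r) + (r + B * suc n)  ≡⟨ cong (_+_ (suc n ∸ r)) A*a≡r+B*n ⟨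
    (suc n ∸ r) + A * a            ∎

parity-even : ∀ {i} → 2 ∣ i → parity i ≡ 0ℙ
parity-even (divides k refl) = trans (ℙ.*-homo-* k 2) (ℙ.*-zeroʳ (parity k))

parity≡0ℙ⇒2∣ : ∀ i → parity i ≡ 0ℙ → 2 ∣ i
parity≡0ℙ⇒2∣ zero          _  = divides 0 refl
parity≡0ℙ⇒2∣ (suc zero)    ()
parity≡0ℙ⇒2∣ (suc (suc i)) eq = ∣m∣n⇒∣m+n ∣-refl (parity≡0ℙ⇒2∣ i eq)

parity-odd : ∀ {i} → 2 ∤ i → parity i ≡ 1ℙ
parity-odd {i} 2∤i with parity i in eq
... | 0ℙ = contradiction (parity≡0ℙ⇒2∣ i eq) 2∤i
... | 1ℙ = refl

<∸1⇒suc< : ∀ {i L} → i < L ∸ 1 → suc i < L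
<∸1⇒suc< {L = zero}  ()
<∸1⇒suc< {L = suc L} i<L = s≤s i<L

lemma17 : (a n : ℕ) → 1 ≤ a → a < n → gcd a n ≡ 1 →
            (∀ i → i < length (contFrac n a) ∸ 1 → 2 ∣ i →
               V₁pt n a i ∈[ P₁ a n ] × 𝒮 a n (V₁pt n a i) ∈[ P₃ a n ])
          × (∀ i → 1 ≤ i → i < length (contFrac n a) ∸ 1 → 2 ∤ i →
               V₂pt n a i ∈[ P₂ a n ] × 𝒮 a n (V₂pt n a i) ∈[ P₄ a n ])
lemma17 a zero    _ ()  _
lemma17 a (suc n) _ a<n _ = even , odd
  where
  lowerHalf : ∀ {i p} → i < length (contFrac (suc n) a) ∸ 1 → parity i ≡ p →
              LowerHalf (suc n) a p (vv (contFrac (suc n) a) i)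
  lowerHalf {i} i<m refl = LowerHalf-vv (suc n) a (ℕ.<⇒≤ a<n) i (<∸1⇒suc< i<m)
  even = λ i i<m 2∣i → let v∈P₁ = LowerHalf⇒∈P₁ (lowerHalf i<m (parity-even 2∣i))
                       in  v∈P₁ , P₁⇒𝒮∈P₃ a (suc n) v∈P₁
  odd  = λ i _ i<m 2∤i → let v∈P₂ = LowerHalf⇒∈P₂ (lowerHalf i<m (parity-odd 2∤i))
                         in  v∈P₂ , P₂⇒𝒮∈P₄ a (suc n) v∈P₂
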